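{- Let $\mathcal{G}$ be an additive abelian group of order $n\ge 2$ and let $m\ge 2$. (i) If $A_1,\dots,A_m$ is an $(n,m,k,1)$-bounded external difference family in $\mathcal{G}$, then the weak AMD code with sources $s_1,\dots,s_m$, $A(s_i)=A_i$ and equiprobable encoding has $\hat\epsilon=\frac1a$ where $a=km$ (i.e. it is G-optimal). (ii) Conversely, if a weak AMD code with $m$ sources over $\mathcal{G}$ and total number of valid encodings $a$ satisfies $\hat\epsilon=\frac1a$, then it is $k$-regular with $k=a/m$ and the sets $A(s)$, $s\in\mathcal{S}$, form an $(n,m,k,1)$-bounded external difference family. Thus G-optimal weak AMD codes are equivalent to $(n,m,k,1)$-bounded external difference families with $a=km$.
   Context: An $(n,m,k,\lambda)$-bounded external difference family (BEDF) in $\mathcal{G}$ is a collection of $m$ pairwise disjoint $k$-subsets $A_1,\dots,A_m$ such that for every $g\in\mathcal{G}\setminus\{0\}$, the number of triples with $x\in A_i$, $y\in A_j$, $i\ne j$, $x-y=g$ is at most $\lambda$. An AMD code with source set $\mathcal{S}$, $|\mathcal{S}|=m$, consists of pairwise disjoint nonempty subsets $A(s)\subseteq\mathcal{G}$ and a public (possibly randomized) encoding function $E$ mapping $s$ to some $g\in A(s)$ with probability $\Pr[E(s)=g]$; $a=\sum_s|A(s)|$. It has equiprobable encoding if $E(s)$ is uniform on $A(s)$, and is $k$-regular if moreover $|A(s)|=k$ for all $s$. Weak security game: the adversary chooses $\Delta\in\mathcal{G}\setminus\{0\}$ by a (possibly randomized) strategy; then $s$ is chosen uniformly from $\mathcal{S}$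 and encoded as $g=E(s)$; the adversary wins iff $g+\Delta\in A(s')$ for some $s'\ne s$. $\hat\epsilon$ is the maximum winning probability over all strategies. -}

module Defs where

open import Data.Nat as ℕ using (ℕ; zero; suc)
open import Data.Fin using (Fin; zero; suc)
open import Data.Fin.Properties using (any?) renaming (_≟_ to _≟ᶠ_)
open import Data.Fin.Subset using (Subset; _∈_; _∉_; ∣_∣)
open import Data.Fin.Subset.Properties using (_∈?_)
open import Data.Integer using (+_)
open import Data.Rational as ℚ using (ℚ; 0ℚ; 1ℚ; _≤_)
open import Data.Product using (Σ; ∃; _×_; _,_)
open import Data.Bool using (if_then_else_)
open import Relation.Nullary using (Dec; does; ¬_)
open import Relation.Nullary.Decidable using (_×-dec_; ¬?)
open import Relation.Binary.PropositionalEquality using (_≡_; _≢_)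
open import Algebra.Structures using (IsAbelianGroup)

sumℕ : ∀ {n} → (Fin n → ℕ) → ℕ
sumℕ {zero}  f = 0
sumℕ {suc n} f = f zero ℕ.+ sumℕ (λ i → f (suc i))

sumℚ : ∀ {n} → (Fin n → ℚ) → ℚ
sumℚ {zero}  f = 0ℚ
sumℚ {suc n} f = f zero ℚ.+ sumℚ (λ i → f (suc i))

𝟙 : ∀ {p} {P : Set p} → Dec P → ℕ
𝟙 d = if does d then 1 else 0

𝟙ℚ : ∀ {p} {P : Set p} → Dec P → ℚ
𝟙ℚ d = if does d then 1ℚ else 0ℚ

-- 1/k as a rational (only used for k ≥ 1; 1/0 is set to 0 by convention)
inv : ℕ → ℚ
inv zero    = 0ℚ
inv (suc k) = + 1 ℚ./ suc k

-- An additive abelian group of order n, represented on the carrier Fin n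
-- (every finite abelian group of order n is isomorphic to such a one).

record FinAbGroup (n : ℕ) : Set where
  field
    _+_  : Fin n → Fin n → Fin n
    0#   : Fin n
    -_   : Fin n → Fin n
    isAbelianGroup : IsAbelianGroup _≡_ _+_ 0# -_

  _-_ : Fin n → Fin n → Fin n
  x - y = x + (- y)

module _ {n : ℕ} (G : FinAbGroup n) where
  open FinAbGroup G

  PairwiseDisjoint : ∀ {m} → (Fin m → Subset n) → Set
  PairwiseDisjoint {m} A = ∀ (i j : Fin m) → i ≢ j → ∀ x → x ∈ A i → x ∈ A j → ⊥'
    where open import Data.Empty renaming (⊥ to ⊥')

  extDiffCount : ∀ {m} → (Fin m → Subset n) → Fin n → ℕ
  extDiffCount A g =
    sumℕ λ i → sumℕ λ j → sumℕ λ x → sumℕ λ y →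
      𝟙 (¬? (i ≟ᶠ j) ×-dec ((x ∈? A i) ×-dec ((y ∈? A j) ×-dec ((x - y) ≟ᶠ g))))

  IsBEDF : (m k lam : ℕ) → (Fin m → Subset n) → Set
  IsBEDF m k lam A =
    (∀ i → ∣ A i ∣ ≡ k) × PairwiseDisjoint A ×
    (∀ g → g ≢ 0# → extDiffCount A g ℕ.≤ lam)

  record AMDCode (m : ℕ) : Set where
    field
      A   : Fin m → Subset n
      E   : Fin m → Fin n → ℚ          -- E s g = Pr[E(s) = g]
      disjoint : PairwiseDisjoint A
      nonempty : ∀ s → ∃ λ g → g ∈ A s
      E-nonneg : ∀ s g → 0ℚ ≤ E s g
      E-support : ∀ s g → g ∉ A s → E s g ≡ 0ℚ
      E-total  : ∀ s → sumℚ (E s) ≡ 1ℚ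

    a : ℕ
    a = sumℕ λ s → ∣ A s ∣

    Equiprobable : Set
    Equiprobable = ∀ s g → g ∈ A s → E s g ≡ inv ∣ A s ∣

    Regular : ℕ → Set
    Regular k = Equiprobable × (∀ s → ∣ A s ∣ ≡ k)

    Hit : Fin m → Fin n → Set
    Hit s x = ∃ λ s' → s' ≢ s × x ∈ A s'

    hit? : ∀ s x → Dec (Hit s x)
    hit? s x = any? (λ s' → ¬? (s' ≟ᶠ s) ×-dec (x ∈? A s'))

    -- winning probability for a fixed Δ, with s uniform on Fin m
    winΔ : Fin n → ℚ
    winΔ Δ = inv m ℚ.* (sumℚ λ s → sumℚ λ g → E s g ℚ.* 𝟙ℚ (hit? s (g + Δ)))

    Strategy : (Fin n → ℚ) → Set
    Strategy p = (∀ Δ → 0ℚ ≤ p Δ) × p 0# ≡ 0ℚ × sumℚ p ≡ 1ℚ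

    win : (Fin n → ℚ) → ℚ
    win p = sumℚ λ Δ → p Δ ℚ.* winΔ Δ

    εhat≡ : ℚ → Set
    εhat≡ r = (∀ p → Strategy p → win p ≤ r) × (∃ λ p → Strategy p × win p ≡ r)

-- Fix a shift Δ ≠ 0 and write win(Δ) for the probability that g + Δ lands in another block,
-- where g encodes a uniform source.  Any randomized adversary wins with a convex combination
-- of the win(Δ), so ε̂ = max_{Δ ≠ 0} win(Δ).  For an equiprobable k-regular code,
-- win(Δ) = N(Δ)/(km), where N(Δ) counts the external differences equal to Δ: hence ε̂ = 1/a
-- exactly when every N(Δ) ≤ 1 (the lower bound comes from a shift between two blocks).
-- Conversely, if ε̂ = 1/a, each encoding g of s gives a shift with win ≥ Pr[E(s) = g]/m, so
-- Pr[E(s) = g] ≤ m/a; summing over A(s) yields a ≤ |A(s)| m for every s, and summing over s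
-- forces equality throughout: all |A(s)| equal k = a/m and the encoding is uniform, after
-- which N(Δ) ≤ 1 follows from the formula above.
module Submission where

open import Data.Nat.Base as ℕ using (ℕ; zero; suc; z≤n; s≤s; NonZero)
import Data.Nat.Properties as ℕ
import Data.Integer.Base as ℤ
import Data.Integer.Properties as ℤ
import Data.Nat.Coprimality as Coprimality
open import Data.Rational.Base as ℚ using (ℚ; mkℚ; 0ℚ; 1ℚ; _*_; _≤_; _<_; 1/_; NonNegative; Positive)
open import Data.Rational.Properties
open import Data.Rational.Solver using (module +-*-Solver)
open import Data.Fin.Base using (Fin; zero; suc; punchIn)
open import Data.Fin.Properties using (suc-injective; punchInᵢ≢i) renaming (_≟_ to _≟ᶠ_)
open import Data.Fin.Subset using (Subset; _∈_; ∣_∣; inside; outside)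
open import Data.Fin.Subset.Properties using (_∈?_; x∈p⇒∣p-x∣<∣p∣)
open import Data.Vec.Base using (_∷_; [])
open import Data.Product.Base using (∃; _×_; _,_; proj₂)
open import Data.Bool.Base using (if_then_else_)
open import Function.Base using (_∘_)
open import Function.Bundles using (_⇔_; mk⇔; Equivalence)
open import Relation.Nullary using (Dec; yes; no; ¬_)
open import Relation.Nullary.Decidable using (_×-dec_; ¬?; dec-true; dec-false; does-⇔)
open import Relation.Binary.PropositionalEquality
open import Algebra.Bundles using (AbelianGroup; CommutativeRing)
open import Algebra.Structures using (IsAbelianGroup)
open import Algebra.Properties.CommutativeSemigroup ℕ.+-commutativeSemigroup using (interchange)
open import Algebra.Properties.Semiring.Mult (CommutativeRing.semiring +-*-commutativeRing)
  using (×-homo-+; ×1-homo-*) renaming (_×_ to _×ℚ_)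
open import Defs

fromℕ : ℕ → ℚ
fromℕ n = n ×ℚ 1ℚ

fromℕ-+ : ∀ a b → fromℕ (a ℕ.+ b) ≡ fromℕ a ℚ.+ fromℕ b
fromℕ-+ = ×-homo-+ 1ℚ

fromℕ-* : ∀ a b → fromℕ (a ℕ.* b) ≡ fromℕ a * fromℕ b
fromℕ-* = ×1-homo-*

fromℕ-nonNeg : ∀ n → 0ℚ ≤ fromℕ n
fromℕ-nonNeg zero    = ≤-refl
fromℕ-nonNeg (suc n) = +-mono-≤ (nonNegative⁻¹ 1ℚ) (fromℕ-nonNeg n)

fromℕ-<-suc : ∀ n → fromℕ n < fromℕ (suc n)
fromℕ-<-suc n = subst (_< fromℕ (suc n)) (+-identityˡ (fromℕ n))
                      (+-mono-<-≤ (positive⁻¹ 1ℚ) (≤-refl {fromℕ n}))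

fromℕ-mono-≤ : ∀ {a b} → a ℕ.≤ b → fromℕ a ≤ fromℕ b
fromℕ-mono-≤ {b = b} z≤n = fromℕ-nonNeg b
fromℕ-mono-≤ (s≤s a≤b)    = +-monoʳ-≤ 1ℚ (fromℕ-mono-≤ a≤b)

fromℕ-cancel-≤ : ∀ {a b} → fromℕ a ≤ fromℕ b → a ℕ.≤ b
fromℕ-cancel-≤ {a} {b} le = ℕ.≮⇒≥ λ b<a →
  <-irrefl refl (<-≤-trans (fromℕ-<-suc b) (≤-trans (fromℕ-mono-≤ b<a) le))

private
  coprime-1 : ∀ n → Coprimality.Coprime n 1
  coprime-1 n = Coprimality.sym (Coprimality.1-coprimeTo n)

  fromℕ≡n/1 : ∀ n → fromℕ n ≡ mkℚ (ℤ.+ n) 0 (coprime-1 n)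
  fromℕ≡n/1 zero    = refl
  fromℕ≡n/1 (suc n) = begin
    1ℚ ℚ.+ fromℕ n                     ≡⟨ cong (1ℚ ℚ.+_) (fromℕ≡n/1 n) ⟩
    (ℤ.+ 1 ℤ.+ ℤ.+ n ℤ.* ℤ.+ 1) ℚ./ 1  ≡⟨ /-cong (cong (ℤ._+_ (ℤ.+ 1)) (ℤ.*-identityʳ (ℤ.+ n))) refl ⟩
    ℤ.+ suc n ℚ./ 1                    ≡⟨ normalize-coprime (coprime-1 (suc n)) ⟩
    mkℚ (ℤ.+ suc n) 0 _                ∎
    where open ≡-Reasoning

  inv≡1/k : ∀ k → inv (suc k) ≡ mkℚ (ℤ.+ 1) k (Coprimality.1-coprimeTo (suc k))
  inv≡1/k k = normalize-coprime (Coprimality.1-coprimeTo (suc k))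

inv-positive : ∀ k .{{_ : NonZero k}} → Positive (inv k)
inv-positive (suc k) = normalize-pos 1 (suc k)

inv-nonNegative : ∀ k → NonNegative (inv k)
inv-nonNegative zero    = _
inv-nonNegative (suc k) = pos⇒nonNeg (inv (suc k)) {{inv-positive (suc k)}}

fromℕ*inv≡1 : ∀ k .{{_ : NonZero k}} → fromℕ k * inv k ≡ 1ℚ
fromℕ*inv≡1 (suc k) = begin
  fromℕ (suc k) * inv (suc k)  ≡⟨ cong₂ _*_ (fromℕ≡n/1 (suc k)) (inv≡1/k k) ⟩
  k+1 * 1/ k+1                 ≡⟨ *-inverseʳ k+1 ⟩
  1ℚ                           ∎
  where
  open ≡-Reasoning
  k+1 = mkℚ (ℤ.+ suc k) 0 (coprime-1 (suc k))

inv-distrib-* : ∀ k m → inv (k ℕ.* m) ≡ inv k * inv m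
inv-distrib-* zero    m       = sym (*-zeroˡ (inv m))
inv-distrib-* (suc k) zero    = trans (cong inv (ℕ.*-zeroʳ k)) (sym (*-zeroʳ (inv (suc k))))
inv-distrib-* (suc k) (suc m) = begin
  inv km
    ≡⟨ *-identityˡ (inv km) ⟨
  1ℚ * inv km
    ≡⟨ cong (_* inv km) (cong₂ _*_ (fromℕ*inv≡1 K) (fromℕ*inv≡1 M)) ⟨
  (fromℕ K * inv K) * (fromℕ M * inv M) * inv km
    ≡⟨ rearrange (fromℕ K) (inv K) (fromℕ M) (inv M) (inv km) ⟩
  inv K * inv M * (fromℕ K * fromℕ M * inv km)
    ≡⟨ cong (λ x → inv K * inv M * (x * inv km)) (fromℕ-* K M) ⟨
  inv K * inv M * (fromℕ km * inv km)
    ≡⟨ cong (inv K * inv M *_) (fromℕ*inv≡1 km) ⟩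
  inv K * inv M * 1ℚ
    ≡⟨ *-identityʳ (inv K * inv M) ⟩
  inv K * inv M
    ∎
  where
  open ≡-Reasoning
  open +-*-Solver
  K = suc k
  M = suc m
  km = K ℕ.* M
  rearrange : ∀ a b c d e → (a * b) * (c * d) * e ≡ b * d * (a * c * e)
  rearrange = solve 5 (λ a b c d e → (a :* b) :* (c :* d) :* e := b :* d :* (a :* c :* e)) refl

fromℕ*inv[k*m]≡inv : ∀ k m .{{_ : NonZero m}} → fromℕ m * inv (k ℕ.* m) ≡ inv k
fromℕ*inv[k*m]≡inv k m = begin
  fromℕ m * inv (k ℕ.* m)      ≡⟨ cong (fromℕ m *_) (inv-distrib-* k m) ⟩
  fromℕ m * (inv k * inv m)    ≡⟨ cong (fromℕ m *_) (*-comm (inv k) (inv m)) ⟩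
  fromℕ m * (inv m * inv k)    ≡⟨ *-assoc (fromℕ m) (inv m) (inv k) ⟨
  fromℕ m * inv m * inv k      ≡⟨ cong (_* inv k) (fromℕ*inv≡1 m) ⟩
  1ℚ * inv k                   ≡⟨ *-identityˡ (inv k) ⟩
  inv k                        ∎
  where open ≡-Reasoning

-- For a = 0 the hypothesis is void, since inv 0 = 0.
1≤fromℕ*inv⇒≤ : ∀ x a → 1ℚ ≤ fromℕ x * inv a → a ℕ.≤ x
1≤fromℕ*inv⇒≤ x zero    _  = z≤n
1≤fromℕ*inv⇒≤ x (suc a) le = fromℕ-cancel-≤ (begin
  A                     ≡⟨ *-identityʳ A ⟨
  A * 1ℚ                ≤⟨ *-monoˡ-≤-nonNeg A {{ℚ.nonNegative (fromℕ-nonNeg (suc a))}} le ⟩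
  A * (fromℕ x * inv a′) ≡⟨ cong (A *_) (*-comm (fromℕ x) (inv a′)) ⟩
  A * (inv a′ * fromℕ x) ≡⟨ *-assoc A (inv a′) (fromℕ x) ⟨
  A * inv a′ * fromℕ x   ≡⟨ cong (_* fromℕ x) (fromℕ*inv≡1 a′) ⟩
  1ℚ * fromℕ x          ≡⟨ *-identityˡ (fromℕ x) ⟩
  fromℕ x               ∎)
  where
  open ≤-Reasoning
  a′ = suc a
  A = fromℕ a′

inv*fromℕ≤inv⇔≤1 : ∀ a .{{_ : NonZero a}} x → (inv a * fromℕ x ≤ inv a) ⇔ (x ℕ.≤ 1)
inv*fromℕ≤inv⇔≤1 a x = mk⇔
  (λ le → fromℕ-cancel-≤ (*-cancelˡ-≤-pos (inv a) {{inv-positive a}}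
                            (subst (inv a * fromℕ x ≤_) (sym inv*1) le)))
  (λ x≤1 → subst (inv a * fromℕ x ≤_) inv*1
                 (*-monoˡ-≤-nonNeg (inv a) {{inv-nonNegative a}} (fromℕ-mono-≤ x≤1)))
  where
  inv*1 : inv a * fromℕ 1 ≡ inv a
  inv*1 = *-identityʳ (inv a)

𝟙-true : ∀ {p} {P : Set p} (d : Dec P) → P → 𝟙 d ≡ 1
𝟙-true d x = cong (if_then 1 else 0) (dec-true d x)

𝟙-false : ∀ {p} {P : Set p} (d : Dec P) → ¬ P → 𝟙 d ≡ 0
𝟙-false d ¬x = cong (if_then 1 else 0) (dec-false d ¬x)

𝟙ℚ-true : ∀ {p} {P : Set p} (d : Dec P) → P → 𝟙ℚ d ≡ 1ℚ
𝟙ℚ-true d x = cong (if_then 1ℚ else 0ℚ) (dec-true d x)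

𝟙ℚ-false : ∀ {p} {P : Set p} (d : Dec P) → ¬ P → 𝟙ℚ d ≡ 0ℚ
𝟙ℚ-false d ¬x = cong (if_then 1ℚ else 0ℚ) (dec-false d ¬x)

𝟙-⇔ : ∀ {p q} {P : Set p} {Q : Set q} (d : Dec P) (e : Dec Q) → P ⇔ Q → 𝟙 d ≡ 𝟙 e
𝟙-⇔ d e P⇔Q = cong (if_then 1 else 0) (does-⇔ P⇔Q d e)

𝟙-× : ∀ {p q} {P : Set p} {Q : Set q} (d : Dec P) (e : Dec Q) → 𝟙 (d ×-dec e) ≡ 𝟙 d ℕ.* 𝟙 e
𝟙-× (yes _) (yes _) = refl
𝟙-× (yes _) (no _)  = refl
𝟙-× (no _)  _       = refl

𝟙ℚ≡fromℕ∘𝟙 : ∀ {p} {P : Set p} (d : Dec P) → 𝟙ℚ d ≡ fromℕ (𝟙 d)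
𝟙ℚ≡fromℕ∘𝟙 (yes _) = refl
𝟙ℚ≡fromℕ∘𝟙 (no _)  = refl

𝟙ℚ-nonNeg : ∀ {p} {P : Set p} (d : Dec P) → 0ℚ ≤ 𝟙ℚ d
𝟙ℚ-nonNeg d = subst (0ℚ ≤_) (sym (𝟙ℚ≡fromℕ∘𝟙 d)) (fromℕ-nonNeg (𝟙 d))

sumℕ-cong : ∀ {n} {f g : Fin n → ℕ} → (∀ i → f i ≡ g i) → sumℕ f ≡ sumℕ g
sumℕ-cong {zero}  f≗g = refl
sumℕ-cong {suc n} f≗g = cong₂ ℕ._+_ (f≗g zero) (sumℕ-cong (f≗g ∘ suc))

sumℕ-zero : ∀ {n} {f : Fin n → ℕ} → (∀ i → f i ≡ 0) → sumℕ f ≡ 0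
sumℕ-zero {zero}  f≗0 = refl
sumℕ-zero {suc n} f≗0 = cong₂ ℕ._+_ (f≗0 zero) (sumℕ-zero (f≗0 ∘ suc))

sumℕ-+ : ∀ {n} (f g : Fin n → ℕ) → sumℕ (λ i → f i ℕ.+ g i) ≡ sumℕ f ℕ.+ sumℕ g
sumℕ-+ {zero}  f g = refl
sumℕ-+ {suc n} f g = trans (cong (f zero ℕ.+ g zero ℕ.+_) (sumℕ-+ (f ∘ suc) (g ∘ suc)))
                           (interchange (f zero) (g zero) _ _)

sumℕ-swap : ∀ {n m} (f : Fin n → Fin m → ℕ) →
            sumℕ (λ i → sumℕ (f i)) ≡ sumℕ (λ j → sumℕ (λ i → f i j))
sumℕ-swap {zero}  {m} f = sym (sumℕ-zero {m} (λ _ → refl))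
sumℕ-swap {suc n} f = trans (cong (sumℕ (f zero) ℕ.+_) (sumℕ-swap (f ∘ suc)))
                            (sym (sumℕ-+ (f zero) _))

sumℕ-*ˡ : ∀ {n} c (f : Fin n → ℕ) → sumℕ (λ i → c ℕ.* f i) ≡ c ℕ.* sumℕ f
sumℕ-*ˡ {zero}  c f = sym (ℕ.*-zeroʳ c)
sumℕ-*ˡ {suc n} c f = trans (cong (c ℕ.* f zero ℕ.+_) (sumℕ-*ˡ c (f ∘ suc)))
                            (sym (ℕ.*-distribˡ-+ c (f zero) _))

sumℕ-*ʳ : ∀ {n} (f : Fin n → ℕ) c → sumℕ (λ i → f i ℕ.* c) ≡ sumℕ f ℕ.* c
sumℕ-*ʳ {zero}  f c = refl
sumℕ-*ʳ {suc n} f c = trans (cong (f zero ℕ.* c ℕ.+_) (sumℕ-*ʳ (f ∘ suc) c))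
                            (sym (ℕ.*-distribʳ-+ c (f zero) _))

sumℕ-const : ∀ {n} c → sumℕ {n} (λ _ → c) ≡ c ℕ.* n
sumℕ-const {zero}  c = sym (ℕ.*-zeroʳ c)
sumℕ-const {suc n} c = trans (cong (c ℕ.+_) (sumℕ-const c)) (sym (ℕ.*-suc c n))

sumℕ-at : ∀ {n} (f : Fin n → ℕ) d → (∀ i → i ≢ d → f i ≡ 0) → sumℕ f ≡ f d
sumℕ-at {suc n} f zero    f≗0 = trans (cong (f zero ℕ.+_) (sumℕ-zero (λ i → f≗0 (suc i) λ ())))
                                      (ℕ.+-identityʳ (f zero))
sumℕ-at {suc n} f (suc d) f≗0 =
  cong₂ ℕ._+_ (f≗0 zero λ ()) (sumℕ-at (f ∘ suc) d (λ i i≢d → f≗0 (suc i) (i≢d ∘ suc-injective)))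

sumℕ-mono-≤ : ∀ {n} {f g : Fin n → ℕ} → (∀ i → f i ℕ.≤ g i) → sumℕ f ℕ.≤ sumℕ g
sumℕ-mono-≤ {zero}  f≤g = z≤n
sumℕ-mono-≤ {suc n} f≤g = ℕ.+-mono-≤ (f≤g zero) (sumℕ-mono-≤ (f≤g ∘ suc))

sumℕ-mono-< : ∀ {n} {f g : Fin n → ℕ} → (∀ i → f i ℕ.≤ g i) → ∀ d → f d ℕ.< g d → sumℕ f ℕ.< sumℕ g
sumℕ-mono-< f≤g zero    fd<gd = ℕ.+-mono-<-≤ fd<gd (sumℕ-mono-≤ (f≤g ∘ suc))
sumℕ-mono-< f≤g (suc d) fd<gd = ℕ.+-mono-≤-< (f≤g zero) (sumℕ-mono-< (f≤g ∘ suc) d fd<gd)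

≤-pointwise∧sumℕ≡⇒≡ : ∀ {n} {f g : Fin n → ℕ} → (∀ i → f i ℕ.≤ g i) → sumℕ f ≡ sumℕ g →
                      ∀ i → f i ≡ g i
≤-pointwise∧sumℕ≡⇒≡ f≤g Σf≡Σg i =
  ℕ.≤-antisym (f≤g i) (ℕ.≮⇒≥ λ fi<gi → ℕ.<-irrefl Σf≡Σg (sumℕ-mono-< f≤g i fi<gi))

sumℚ-cong : ∀ {n} {f g : Fin n → ℚ} → (∀ i → f i ≡ g i) → sumℚ f ≡ sumℚ g
sumℚ-cong {zero}  f≗g = refl
sumℚ-cong {suc n} f≗g = cong₂ ℚ._+_ (f≗g zero) (sumℚ-cong (f≗g ∘ suc))

sumℚ-zero : ∀ {n} {f : Fin n → ℚ} → (∀ i → f i ≡ 0ℚ) → sumℚ f ≡ 0ℚ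
sumℚ-zero {zero}  f≗0 = refl
sumℚ-zero {suc n} f≗0 = cong₂ ℚ._+_ (f≗0 zero) (sumℚ-zero (f≗0 ∘ suc))

sumℚ-at : ∀ {n} (f : Fin n → ℚ) d → (∀ i → i ≢ d → f i ≡ 0ℚ) → sumℚ f ≡ f d
sumℚ-at {suc n} f zero    f≗0 = trans (cong (f zero ℚ.+_) (sumℚ-zero (λ i → f≗0 (suc i) λ ())))
                                      (+-identityʳ (f zero))
sumℚ-at {suc n} f (suc d) f≗0 =
  trans (cong₂ ℚ._+_ (f≗0 zero λ ())
                     (sumℚ-at (f ∘ suc) d (λ i i≢d → f≗0 (suc i) (i≢d ∘ suc-injective))))
        (+-identityˡ (f (suc d)))

sumℚ-*ˡ : ∀ {n} c (f : Fin n → ℚ) → sumℚ (λ i → c * f i) ≡ c * sumℚ f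
sumℚ-*ˡ {zero}  c f = sym (*-zeroʳ c)
sumℚ-*ˡ {suc n} c f = trans (cong (c * f zero ℚ.+_) (sumℚ-*ˡ c (f ∘ suc)))
                            (sym (*-distribˡ-+ c (f zero) _))

sumℚ-*ʳ : ∀ {n} c (f : Fin n → ℚ) → sumℚ (λ i → f i * c) ≡ sumℚ f * c
sumℚ-*ʳ c f = trans (sumℚ-cong (λ i → *-comm (f i) c)) (trans (sumℚ-*ˡ c f) (*-comm c (sumℚ f)))

sumℚ-fromℕ : ∀ {n} (f : Fin n → ℕ) → sumℚ (λ i → fromℕ (f i)) ≡ fromℕ (sumℕ f)
sumℚ-fromℕ {zero}  f = refl
sumℚ-fromℕ {suc n} f = trans (cong (fromℕ (f zero) ℚ.+_) (sumℚ-fromℕ (f ∘ suc)))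
                             (sym (fromℕ-+ (f zero) _))

sumℚ-*fromℕ : ∀ {n} c (f : Fin n → ℕ) → sumℚ (λ i → c * fromℕ (f i)) ≡ c * fromℕ (sumℕ f)
sumℚ-*fromℕ c f = trans (sumℚ-*ˡ c (fromℕ ∘ f)) (cong (c *_) (sumℚ-fromℕ f))

sumℚ-𝟙ℚ-∈ : ∀ {n} (p : Subset n) → sumℚ (λ x → 𝟙ℚ (x ∈? p)) ≡ fromℕ ∣ p ∣
sumℚ-𝟙ℚ-∈ []            = refl
sumℚ-𝟙ℚ-∈ (inside  ∷ p) = cong (1ℚ ℚ.+_) (sumℚ-𝟙ℚ-∈ p)
sumℚ-𝟙ℚ-∈ (outside ∷ p) = trans (+-identityˡ _) (sumℚ-𝟙ℚ-∈ p)

sumℚ-𝟙ℚ-∈* : ∀ {n} (p : Subset n) c → sumℚ (λ x → 𝟙ℚ (x ∈? p) * c) ≡ fromℕ ∣ p ∣ * c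
sumℚ-𝟙ℚ-∈* p c = trans (sumℚ-*ʳ c (λ x → 𝟙ℚ (x ∈? p))) (cong (_* c) (sumℚ-𝟙ℚ-∈ p))

sumℚ-mono-≤ : ∀ {n} {f g : Fin n → ℚ} → (∀ i → f i ≤ g i) → sumℚ f ≤ sumℚ g
sumℚ-mono-≤ {zero}  f≤g = ≤-refl
sumℚ-mono-≤ {suc n} f≤g = +-mono-≤ (f≤g zero) (sumℚ-mono-≤ (f≤g ∘ suc))

sumℚ-mono-< : ∀ {n} {f g : Fin n → ℚ} → (∀ i → f i ≤ g i) → ∀ d → f d < g d → sumℚ f < sumℚ g
sumℚ-mono-< f≤g zero    fd<gd = +-mono-<-≤ fd<gd (sumℚ-mono-≤ (f≤g ∘ suc))
sumℚ-mono-< f≤g (suc d) fd<gd = +-mono-≤-< (f≤g zero) (sumℚ-mono-< (f≤g ∘ suc) d fd<gd)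

≤-pointwise∧sumℚ≡⇒≡ : ∀ {n} {f g : Fin n → ℚ} → (∀ i → f i ≤ g i) → sumℚ f ≡ sumℚ g →
                      ∀ i → f i ≡ g i
≤-pointwise∧sumℚ≡⇒≡ f≤g Σf≡Σg i =
  ≤-antisym (f≤g i) (≮⇒≥ λ fi<gi → <-irrefl Σf≡Σg (sumℚ-mono-< f≤g i fi<gi))

sumℚ-nonNeg : ∀ {n} {f : Fin n → ℚ} → (∀ i → 0ℚ ≤ f i) → 0ℚ ≤ sumℚ f
sumℚ-nonNeg {zero}  f≥0 = ≤-refl
sumℚ-nonNeg {suc n} f≥0 = +-mono-≤ (f≥0 zero) (sumℚ-nonNeg (f≥0 ∘ suc))

sumℚ-≥-term : ∀ {n} {f : Fin n → ℚ} → (∀ i → 0ℚ ≤ f i) → ∀ d → f d ≤ sumℚ f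
sumℚ-≥-term {suc n} {f} f≥0 zero    =
  subst (_≤ sumℚ f) (+-identityʳ (f zero)) (+-monoʳ-≤ (f zero) (sumℚ-nonNeg (f≥0 ∘ suc)))
sumℚ-≥-term {suc n} {f} f≥0 (suc d) =
  subst (_≤ sumℚ f) (+-identityˡ (f (suc d))) (+-mono-≤ (f≥0 zero) (sumℚ-≥-term (f≥0 ∘ suc) d))

module _ {n} (G : FinAbGroup n) where
  open FinAbGroup G

  private
    abelianGroup : AbelianGroup _ _
    abelianGroup = record
      { Carrier = Fin n ; _≈_ = _≡_ ; _∙_ = _+_ ; ε = 0# ; _⁻¹ = -_ ; isAbelianGroup = isAbelianGroup }

  open import Algebra.Properties.AbelianGroup abelianGroup using (xyx⁻¹≈y; x∙y⁻¹≈ε⇒x≈y)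
  open IsAbelianGroup isAbelianGroup using (assoc)

  x+[y-x]≡y : ∀ x y → x + (y - x) ≡ y
  x+[y-x]≡y x y = trans (sym (assoc x y (- x))) (xyx⁻¹≈y x y)

  [x+y]-x≡y : ∀ x y → (x + y) - x ≡ y
  [x+y]-x≡y = xyx⁻¹≈y

  x-y≡0⇒x≡y : ∀ {x y} → x - y ≡ 0# → x ≡ y
  x-y≡0⇒x≡y = x∙y⁻¹≈ε⇒x≈y _ _

∃≢ : ∀ {m} → 2 ℕ.≤ m → (s : Fin m) → ∃ λ s' → s' ≢ s
∃≢ {suc (suc _)} _ s = punchIn s zero , punchInᵢ≢i s zero
∃≢ {suc zero} (s≤s ()) _

module _ {n} (G : FinAbGroup n) {m} (C : AMDCode G m) where
  open FinAbGroup G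
  open AMDCode C

  ∣A∣≢0 : ∀ s → NonZero ∣ A s ∣
  ∣A∣≢0 s = ℕ.>-nonZero (ℕ.≤-trans (s≤s z≤n) (x∈p⇒∣p-x∣<∣p∣ (proj₂ (nonempty s))))

  extDiffTerm : Fin n → Fin m → Fin m → Fin n → Fin n → ℕ
  extDiffTerm Δ i j x y = 𝟙 (¬? (i ≟ᶠ j) ×-dec ((x ∈? A i) ×-dec ((y ∈? A j) ×-dec ((x - y) ≟ᶠ Δ))))

  other? : ∀ s' s z → Dec (s' ≢ s × z ∈ A s')
  other? s' s z = ¬? (s' ≟ᶠ s) ×-dec (z ∈? A s')

  hits : Fin n → Fin m → Fin n → ℕ
  hits Δ s g = 𝟙 (g ∈? A s) ℕ.* 𝟙 (hit? s (g + Δ))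

  hitCount : Fin n → ℕ
  hitCount Δ = sumℕ λ s → sumℕ (hits Δ s)

  -- by disjointness at most one summand is nonzero
  sumℕ-𝟙-other≡𝟙-hit : ∀ s z → sumℕ (λ s' → 𝟙 (other? s' s z)) ≡ 𝟙 (hit? s z)
  sumℕ-𝟙-other≡𝟙-hit s z with hit? s z
  ... | yes (s' , s'≢s , z∈A') = trans (sumℕ-at _ s' only-s') (𝟙-true (other? s' s z) (s'≢s , z∈A'))
    where
    only-s' : ∀ i → i ≢ s' → 𝟙 (other? i s z) ≡ 0
    only-s' i i≢s' = 𝟙-false (other? i s z) λ (_ , z∈Ai) → disjoint i s' i≢s' z z∈Ai z∈A'
  ... | no ¬hit = sumℕ-zero λ i → 𝟙-false (other? i s z) λ (i≢s , z∈Ai) → ¬hit (i , i≢s , z∈Ai)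

  sumℕ-extDiffTerm : ∀ Δ i j y →
                     sumℕ (λ x → extDiffTerm Δ i j x y) ≡ 𝟙 (y ∈? A j) ℕ.* 𝟙 (other? i j (y + Δ))
  sumℕ-extDiffTerm Δ i j y = begin
    sumℕ (λ x → 𝟙 (term x))
      ≡⟨ sumℕ-at _ (y + Δ) (λ x x≢y+Δ → 𝟙-false (term x)
                              λ (_ , _ , _ , x-y≡Δ) → x≢y+Δ (x≡y+Δ x-y≡Δ)) ⟩
    𝟙 (term (y + Δ))
      ≡⟨ 𝟙-⇔ (term (y + Δ)) ((y ∈? A j) ×-dec other? i j (y + Δ)) reorder ⟩
    𝟙 ((y ∈? A j) ×-dec other? i j (y + Δ))
      ≡⟨ 𝟙-× (y ∈? A j) (other? i j (y + Δ)) ⟩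
    𝟙 (y ∈? A j) ℕ.* 𝟙 (other? i j (y + Δ)) ∎
    where
    open ≡-Reasoning
    term = λ x → ¬? (i ≟ᶠ j) ×-dec ((x ∈? A i) ×-dec ((y ∈? A j) ×-dec ((x - y) ≟ᶠ Δ)))
    x≡y+Δ : ∀ {x} → x - y ≡ Δ → x ≡ y + Δ
    x≡y+Δ {x} x-y≡Δ = trans (sym (x+[y-x]≡y G y x)) (cong (y +_) x-y≡Δ)
    reorder = mk⇔ (λ (i≢j , x∈Ai , y∈Aj , _) → y∈Aj , i≢j , x∈Ai)
                  (λ (y∈Aj , i≢j , x∈Ai) → i≢j , x∈Ai , y∈Aj , [x+y]-x≡y G y Δ)

  extDiffCount≡hitCount : ∀ Δ → extDiffCount G A Δ ≡ hitCount Δ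
  extDiffCount≡hitCount Δ = begin
    sumℕ (λ i → sumℕ λ j → sumℕ λ x → sumℕ λ y → T i j x y)
      ≡⟨ sumℕ-swap (λ i j → sumℕ λ x → sumℕ λ y → T i j x y) ⟩
    sumℕ (λ j → sumℕ λ i → sumℕ λ x → sumℕ λ y → T i j x y)
      ≡⟨ sumℕ-cong (λ j → trans (sumℕ-cong (λ i → sumℕ-swap (T i j)))
                                (sumℕ-swap (λ i y → sumℕ λ x → T i j x y))) ⟩
    sumℕ (λ j → sumℕ λ y → sumℕ λ i → sumℕ λ x → T i j x y)
      ≡⟨ sumℕ-cong (λ j → sumℕ-cong (λ y → column j y)) ⟩
    hitCount Δ ∎
    where
    open ≡-Reasoning
    T = extDiffTerm Δ
    column : ∀ j y → sumℕ (λ i → sumℕ λ x → T i j x y) ≡ hits Δ j y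
    column j y = begin
      sumℕ (λ i → sumℕ λ x → T i j x y)
        ≡⟨ sumℕ-cong (λ i → sumℕ-extDiffTerm Δ i j y) ⟩
      sumℕ (λ i → 𝟙 (y ∈? A j) ℕ.* 𝟙 (other? i j (y + Δ)))
        ≡⟨ sumℕ-*ˡ (𝟙 (y ∈? A j)) (λ i → 𝟙 (other? i j (y + Δ))) ⟩
      𝟙 (y ∈? A j) ℕ.* sumℕ (λ i → 𝟙 (other? i j (y + Δ)))
        ≡⟨ cong (𝟙 (y ∈? A j) ℕ.*_) (sumℕ-𝟙-other≡𝟙-hit j (y + Δ)) ⟩
      hits Δ j y
        ∎

  winΔ-regular : ∀ {k} → Equiprobable → (∀ s → ∣ A s ∣ ≡ k) → ∀ Δ →
                 winΔ Δ ≡ inv (k ℕ.* m) * fromℕ (extDiffCount G A Δ)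
  winΔ-regular {k} equiprobable sizes Δ = begin
    inv m * sumℚ (λ s → sumℚ λ g → E s g * 𝟙ℚ (hit? s (g + Δ)))
      ≡⟨ cong (inv m *_) (sumℚ-cong λ s → sumℚ-cong λ g → weighted-hit s g) ⟩
    inv m * sumℚ (λ s → sumℚ λ g → inv k * fromℕ (hits Δ s g))
      ≡⟨ cong (inv m *_) (trans (sumℚ-cong λ s → sumℚ-*fromℕ (inv k) (hits Δ s))
                                (sumℚ-*fromℕ (inv k) (λ s → sumℕ (hits Δ s)))) ⟩
    inv m * (inv k * fromℕ (hitCount Δ))
      ≡⟨ *-assoc (inv m) (inv k) _ ⟨
    inv m * inv k * fromℕ (hitCount Δ)
      ≡⟨ cong₂ _*_ (trans (*-comm (inv m) (inv k)) (sym (inv-distrib-* k m)))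
                   (cong fromℕ (sym (extDiffCount≡hitCount Δ))) ⟩
    inv (k ℕ.* m) * fromℕ (extDiffCount G A Δ) ∎
    where
    open ≡-Reasoning
    weighted-hit : ∀ s g → E s g * 𝟙ℚ (hit? s (g + Δ)) ≡ inv k * fromℕ (hits Δ s g)
    weighted-hit s g with g ∈? A s
    ... | yes g∈A = cong₂ _*_ (trans (equiprobable s g g∈A) (cong inv (sizes s)))
                              (trans (𝟙ℚ≡fromℕ∘𝟙 (hit? s (g + Δ)))
                                     (cong fromℕ (sym (ℕ.*-identityˡ (𝟙 (hit? s (g + Δ)))))))
    ... | no g∉A  = trans (cong (_* 𝟙ℚ (hit? s (g + Δ))) (E-support s g g∉A))
                          (trans (*-zeroˡ (𝟙ℚ (hit? s (g + Δ)))) (sym (*-zeroʳ (inv k))))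

  winΔ-≥ : ∀ {s g Δ} → Hit s (g + Δ) → inv m * E s g ≤ winΔ Δ
  winΔ-≥ {s} {g} {Δ} hit = *-monoˡ-≤-nonNeg (inv m) {{inv-nonNegative m}} (begin
    E s g                             ≡⟨ *-identityʳ (E s g) ⟨
    E s g * 1ℚ                        ≡⟨ cong (E s g *_) (𝟙ℚ-true (hit? s (g + Δ)) hit) ⟨
    gain s g                          ≤⟨ sumℚ-≥-term (gain-nonNeg s) g ⟩
    sumℚ (gain s)                     ≤⟨ sumℚ-≥-term (λ s' → sumℚ-nonNeg (gain-nonNeg s')) s ⟩
    sumℚ (λ s' → sumℚ (gain s'))      ∎)
    where
    open ≤-Reasoning
    gain : Fin m → Fin n → ℚ
    gain s' g' = E s' g' * 𝟙ℚ (hit? s' (g' + Δ))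
    gain-nonNeg : ∀ s' g' → 0ℚ ≤ gain s' g'
    gain-nonNeg s' g' = nonNegative⁻¹ (gain s' g')
      {{nonNeg*nonNeg⇒nonNeg (E s' g') {{ℚ.nonNegative (E-nonneg s' g')}}
                             (𝟙ℚ (hit? s' (g' + Δ))) {{ℚ.nonNegative (𝟙ℚ-nonNeg (hit? s' (g' + Δ)))}}}}

  -- the shift carrying an encoding of s onto an encoding of another source
  ∃-shift : 2 ℕ.≤ m → ∀ {s g} → g ∈ A s → ∃ λ Δ → Δ ≢ 0# × inv m * E s g ≤ winΔ Δ
  ∃-shift m≥2 {s} {g} g∈A with ∃≢ m≥2 s
  ... | s' , s'≢s with nonempty s'
  ... | h , h∈A' = h - g , h-g≢0 , winΔ-≥ (s' , s'≢s , subst (_∈ A s') (sym (x+[y-x]≡y G g h)) h∈A')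
    where
    h-g≢0 : h - g ≢ 0#
    h-g≢0 h-g≡0 = disjoint s s' (s'≢s ∘ sym) g g∈A (subst (_∈ A s') (x-y≡0⇒x≡y G h-g≡0) h∈A')

  pointMass : Fin n → Fin n → ℚ
  pointMass Δ x = 𝟙ℚ (x ≟ᶠ Δ)

  pointMass-strategy : ∀ {Δ} → Δ ≢ 0# → Strategy (pointMass Δ)
  pointMass-strategy {Δ} Δ≢0 =
    (λ x → 𝟙ℚ-nonNeg (x ≟ᶠ Δ)) ,
    𝟙ℚ-false (0# ≟ᶠ Δ) (Δ≢0 ∘ sym) ,
    trans (sumℚ-at (pointMass Δ) Δ (λ x → 𝟙ℚ-false (x ≟ᶠ Δ))) (𝟙ℚ-true (Δ ≟ᶠ Δ) refl)

  win-pointMass : ∀ Δ → win (pointMass Δ) ≡ winΔ Δ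
  win-pointMass Δ = begin
    sumℚ (λ x → pointMass Δ x * winΔ x)  ≡⟨ sumℚ-at _ Δ (λ x x≢Δ → trans (cong (_* winΔ x) (𝟙ℚ-false (x ≟ᶠ Δ) x≢Δ))
                                                                      (*-zeroˡ (winΔ x))) ⟩
    pointMass Δ Δ * winΔ Δ               ≡⟨ cong (_* winΔ Δ) (𝟙ℚ-true (Δ ≟ᶠ Δ) refl) ⟩
    1ℚ * winΔ Δ                      ≡⟨ *-identityˡ (winΔ Δ) ⟩
    winΔ Δ                           ∎
    where open ≡-Reasoning

  win-≤ : ∀ {r p} → (∀ Δ → Δ ≢ 0# → winΔ Δ ≤ r) → Strategy p → win p ≤ r
  win-≤ {r} {p} bound (p≥0 , p0≡0 , Σp≡1) = begin
    sumℚ (λ Δ → p Δ * winΔ Δ)  ≤⟨ sumℚ-mono-≤ weighted-≤ ⟩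
    sumℚ (λ Δ → p Δ * r)       ≡⟨ sumℚ-*ʳ r p ⟩
    sumℚ p * r                 ≡⟨ cong (_* r) Σp≡1 ⟩
    1ℚ * r                     ≡⟨ *-identityˡ r ⟩
    r                          ∎
    where
    open ≤-Reasoning
    weighted-≤ : ∀ Δ → p Δ * winΔ Δ ≤ p Δ * r
    weighted-≤ Δ with Δ ≟ᶠ 0#
    ... | yes refl = ≤-reflexive (begin-equality
      p 0# * winΔ 0#   ≡⟨ cong (_* winΔ 0#) p0≡0 ⟩
      0ℚ * winΔ 0#     ≡⟨ *-zeroˡ (winΔ 0#) ⟩
      0ℚ               ≡⟨ *-zeroˡ r ⟨
      0ℚ * r           ≡⟨ cong (_* r) p0≡0 ⟨
      p 0# * r         ∎)
    ... | no Δ≢0 = *-monoˡ-≤-nonNeg (p Δ) {{ℚ.nonNegative (p≥0 Δ)}} (bound Δ Δ≢0)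

  εhat≡-intro : ∀ {r} → (∀ Δ → Δ ≢ 0# → winΔ Δ ≤ r) → ∀ Δ → Δ ≢ 0# → winΔ Δ ≡ r → εhat≡ r
  εhat≡-intro bound Δ Δ≢0 winΔ≡r =
    (λ _ → win-≤ bound) , pointMass Δ , pointMass-strategy Δ≢0 , trans (win-pointMass Δ) winΔ≡r

  εhat≡⇒winΔ-≤ : ∀ {r} → εhat≡ r → ∀ Δ → Δ ≢ 0# → winΔ Δ ≤ r
  εhat≡⇒winΔ-≤ (optimal , _) Δ Δ≢0 =
    subst (_≤ _) (win-pointMass Δ) (optimal (pointMass Δ) (pointMass-strategy Δ≢0))

  εhat≡⇒E-≤ : ∀ {r} .{{_ : NonZero m}} → 2 ℕ.≤ m → εhat≡ r → ∀ s g → g ∈ A s → E s g ≤ fromℕ m * r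
  εhat≡⇒E-≤ {r} m≥2 optimal s g g∈A with ∃-shift m≥2 g∈A
  ... | Δ , Δ≢0 , E/m≤winΔ = begin
    E s g                       ≡⟨ *-identityˡ (E s g) ⟨
    1ℚ * E s g                  ≡⟨ cong (_* E s g) (fromℕ*inv≡1 m) ⟨
    fromℕ m * inv m * E s g     ≡⟨ *-assoc (fromℕ m) (inv m) (E s g) ⟩
    fromℕ m * (inv m * E s g)   ≤⟨ *-monoˡ-≤-nonNeg (fromℕ m) {{ℚ.nonNegative (fromℕ-nonNeg m)}}
                                     (≤-trans E/m≤winΔ (εhat≡⇒winΔ-≤ optimal Δ Δ≢0)) ⟩
    fromℕ m * r                 ∎
    where open ≤-Reasoning

  E-≤⇒E-≤-𝟙ℚ* : ∀ {s c} → (∀ g → g ∈ A s → E s g ≤ c) → ∀ g → E s g ≤ 𝟙ℚ (g ∈? A s) * c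
  E-≤⇒E-≤-𝟙ℚ* {s} {c} E≤c g with g ∈? A s
  ... | yes g∈A = subst (E s g ≤_) (sym (*-identityˡ c)) (E≤c g g∈A)
  ... | no g∉A  = ≤-reflexive (trans (E-support s g g∉A) (sym (*-zeroˡ c)))

  E-≤⇒1≤∣A∣* : ∀ {s c} → (∀ g → g ∈ A s → E s g ≤ c) → 1ℚ ≤ fromℕ ∣ A s ∣ * c
  E-≤⇒1≤∣A∣* {s} {c} E≤c = begin
    1ℚ                                ≡⟨ E-total s ⟨
    sumℚ (E s)                        ≤⟨ sumℚ-mono-≤ (E-≤⇒E-≤-𝟙ℚ* E≤c) ⟩
    sumℚ (λ g → 𝟙ℚ (g ∈? A s) * c)    ≡⟨ sumℚ-𝟙ℚ-∈* (A s) c ⟩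
    fromℕ ∣ A s ∣ * c                 ∎
    where open ≤-Reasoning

  -- the bound is attained on average, hence everywhere
  E-≤-inv⇒E≡inv : ∀ {s} → (∀ g → g ∈ A s → E s g ≤ inv ∣ A s ∣) →
                  ∀ g → g ∈ A s → E s g ≡ inv ∣ A s ∣
  E-≤-inv⇒E≡inv {s} E≤inv g g∈A = begin
    E s g                                  ≡⟨ ≤-pointwise∧sumℚ≡⇒≡ (E-≤⇒E-≤-𝟙ℚ* E≤inv) total g ⟩
    𝟙ℚ (g ∈? A s) * inv ∣ A s ∣             ≡⟨ cong (_* inv ∣ A s ∣) (𝟙ℚ-true (g ∈? A s) g∈A) ⟩
    1ℚ * inv ∣ A s ∣                        ≡⟨ *-identityˡ (inv ∣ A s ∣) ⟩
    inv ∣ A s ∣                             ∎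
    where
    open ≡-Reasoning
    total : sumℚ (E s) ≡ sumℚ (λ g → 𝟙ℚ (g ∈? A s) * inv ∣ A s ∣)
    total = trans (E-total s)
                  (sym (trans (sumℚ-𝟙ℚ-∈* (A s) (inv ∣ A s ∣)) (fromℕ*inv≡1 ∣ A s ∣ {{∣A∣≢0 s}})))

bedf⇒optimal : ∀ {n m} → 2 ℕ.≤ m → (G : FinAbGroup n) (C : AMDCode G m) → ∀ {k} → 1 ℕ.≤ k →
               IsBEDF G m k 1 (AMDCode.A C) → AMDCode.Equiprobable C →
               AMDCode.a C ≡ k ℕ.* m × AMDCode.εhat≡ C (inv (AMDCode.a C))
bedf⇒optimal {m = m} m≥2@(s≤s (s≤s _)) G C {k} (s≤s _) (sizes , _ , bounded) equiprobable =
  a≡k*m , subst εhat≡ (cong inv (sym a≡k*m)) (optimal (proj₂ (nonempty zero)))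
  where
  open FinAbGroup G
  open AMDCode C
  a≡k*m : a ≡ k ℕ.* m
  a≡k*m = trans (sumℕ-cong sizes) (sumℕ-const k)
  upper : ∀ Δ → Δ ≢ 0# → winΔ Δ ≤ inv (k ℕ.* m)
  upper Δ Δ≢0 = subst (_≤ inv (k ℕ.* m)) (sym (winΔ-regular G C equiprobable sizes Δ))
                      (Equivalence.from (inv*fromℕ≤inv⇔≤1 (k ℕ.* m) _) (bounded Δ Δ≢0))
  optimal : ∀ {g} → g ∈ A zero → εhat≡ (inv (k ℕ.* m))
  optimal {g} g∈A with ∃-shift G C m≥2 g∈A
  ... | Δ , Δ≢0 , E/m≤winΔ =
    εhat≡-intro G C upper Δ Δ≢0 (≤-antisym (upper Δ Δ≢0) (subst (_≤ winΔ Δ) E/m≡inv-km E/m≤winΔ))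
    where
    E/m≡inv-km : inv m * E zero g ≡ inv (k ℕ.* m)
    E/m≡inv-km = trans (cong (inv m *_) (trans (equiprobable zero g g∈A) (cong inv (sizes zero))))
                       (trans (*-comm (inv m) (inv k)) (sym (inv-distrib-* k m)))

optimal⇒regular-bedf : ∀ {n m} → 2 ℕ.≤ m → (G : FinAbGroup n) (C : AMDCode G m) →
                       AMDCode.εhat≡ C (inv (AMDCode.a C)) →
                       ∃ λ k → AMDCode.a C ≡ k ℕ.* m × AMDCode.Regular C k × IsBEDF G m k 1 (AMDCode.A C)
optimal⇒regular-bedf {m = m} m≥2@(s≤s (s≤s _)) G C optimal =
  k , a≡k*m , (equiprobable , sizes) , sizes , disjoint , bounded
  where
  open FinAbGroup G
  open AMDCode C
  a≤∣A∣*m : ∀ s → a ℕ.≤ ∣ A s ∣ ℕ.* m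
  a≤∣A∣*m s = 1≤fromℕ*inv⇒≤ (∣ A s ∣ ℕ.* m) a
    (subst (1ℚ ≤_) regroup (E-≤⇒1≤∣A∣* G C (εhat≡⇒E-≤ G C m≥2 optimal s)))
    where
    regroup : fromℕ ∣ A s ∣ * (fromℕ m * inv a) ≡ fromℕ (∣ A s ∣ ℕ.* m) * inv a
    regroup = trans (sym (*-assoc (fromℕ ∣ A s ∣) (fromℕ m) (inv a)))
                    (cong (_* inv a) (sym (fromℕ-* ∣ A s ∣ m)))
  ∣A∣*m≡a : ∀ s → ∣ A s ∣ ℕ.* m ≡ a
  ∣A∣*m≡a s = sym (≤-pointwise∧sumℕ≡⇒≡ a≤∣A∣*m (trans (sumℕ-const a) (sym (sumℕ-*ʳ (λ s → ∣ A s ∣) m))) s)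
  k = ∣ A zero ∣
  sizes : ∀ s → ∣ A s ∣ ≡ k
  sizes s = ℕ.*-cancelʳ-≡ ∣ A s ∣ k m (trans (∣A∣*m≡a s) (sym (∣A∣*m≡a zero)))
  a≡k*m : a ≡ k ℕ.* m
  a≡k*m = sym (∣A∣*m≡a zero)
  equiprobable : Equiprobable
  equiprobable s = E-≤-inv⇒E≡inv G C λ g g∈A →
    subst (E s g ≤_) m/a≡1/∣A∣ (εhat≡⇒E-≤ G C m≥2 optimal s g g∈A)
    where
    m/a≡1/∣A∣ : fromℕ m * inv a ≡ inv ∣ A s ∣
    m/a≡1/∣A∣ = trans (cong (λ x → fromℕ m * inv x) a≡k*m)
                      (trans (fromℕ*inv[k*m]≡inv k m) (cong inv (sym (sizes s))))
  bounded : ∀ Δ → Δ ≢ 0# → extDiffCount G A Δ ℕ.≤ 1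
  bounded Δ Δ≢0 = Equivalence.to (inv*fromℕ≤inv⇔≤1 (k ℕ.* m) {{ℕ.m*n≢0 k m {{∣A∣≢0 G C zero}}}} _)
    (subst₂ _≤_ (winΔ-regular G C equiprobable sizes Δ) (cong inv a≡k*m) (εhat≡⇒winΔ-≤ G C optimal Δ Δ≢0))

mainTheorem11 : (n m : ℕ) → 2 ℕ.≤ n → 2 ℕ.≤ m → (G : FinAbGroup n) →
  ((k : ℕ) → 1 ℕ.≤ k → (C : AMDCode G m) →
    IsBEDF G m k 1 (AMDCode.A C) → AMDCode.Equiprobable C →
    AMDCode.a C ≡ k ℕ.* m × AMDCode.εhat≡ C (inv (AMDCode.a C)))
  ×
  ((C : AMDCode G m) → AMDCode.εhat≡ C (inv (AMDCode.a C)) →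
    ∃ λ k → AMDCode.a C ≡ k ℕ.* m × AMDCode.Regular C k × IsBEDF G m k 1 (AMDCode.A C))
mainTheorem11 _ _ _ m≥2 G =
  (λ k k≥1 C → bedf⇒optimal m≥2 G C k≥1) , optimal⇒regular-bedf m≥2 G
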